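{- Let $\mathrm{XORUnification}$ be the XOR-unification algorithm described in the context. For every unification problem $P$ and every substitution $\sigma$, if $\mathrm{XORUnification}(P)$ returns $\sigma$, then $\sigma$ is a most general XOR-unifier of $P$: $\sigma$ solves $P$, and for every substitution $\theta$ solving $P$ there is a substitution $\rho$ with $\theta(x)\approx_{XOR}\rho(\sigma(x))$ for every variable $x$.
   Context: Terms are built from constants $C(n)$ ($n\in\mathbb{N}$), variables (indexed by strings), and a binary operator $\oplus$; the constant $0:=C(0)$ is the unit. The relation $\approx_{XOR}$ is the smallest congruence on terms (reflexive, symmetric, transitive, compatible with $\oplus$) containing associativity $(x\oplus y)\oplus z\approx x\oplus(y\oplus z)$, commutativity $x\oplus y\approx y\oplus x$, unity $0\oplus x\approx x$ and nilpotency $x\oplus x\approx 0$. A substitution maps variables to terms (identity on all but finitely many) and is extended homomorphically to terms. A unification problem is a finite list of equations $s\approx^? t$; a substitution solves it if $\sigma(s)\approx_{XOR}\sigma(t)$ for each equation. The algorithm $\mathrm{XORUnification}$: each equation $s\approx^?t$ is rewritten as $s\oplus t\approx^?0$ and the left side is put in a normal form modulo $\approx_{XOR}$ (a list of atoms with cancelled duplicate pairs and removed $0$'s); one starts with the pair $\Gamma\|\Lambda$ with $\Gamma$ these equations and $\Lambda=\emptyset$, and repeatedly applies the first applicable of the rules (Trivial) $\Gamma\cup\{0\approx^?0\}\|\Lambda\ \Rightarrow\ \Gamma\|\Lambda$ and (Variable Substitution) $\Gamma\cup\{x\oplus S\approx^?0\}\|\Lambda\ \Rightarrow\ \sigma\Gamma\|\sigma\Lambda\cup\{x\approx^?S\}$,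 where $x$ is a variable not occurring in $S$ and $\sigma=\{x\mapsto S\}$ (results re-normalized). When no rule applies, if $\Gamma$ is empty the algorithm returns the substitution $\{x\mapsto S : (x\approx^?S)\in\Lambda\}$, and otherwise returns None. -}

module Defs where

open import Data.Nat using (ℕ; zero; suc)
import Data.Nat as ℕ
open import Data.String using (String)
import Data.String as Str
open import Data.Bool using (Bool; true; false; if_then_else_)
open import Data.List using (List; []; _∷_; _++_; map; concatMap; foldr)
open import Data.List.Relation.Unary.All using (All)
open import Data.List.Membership.Propositional using (_∉_)
open import Data.List.Relation.Binary.Permutation.Propositional using (_↭_)
open import Data.Product using (_×_; _,_; Σ; ∃; proj₁; proj₂)
open import Relation.Nullary using (does; ¬_)
open import Relation.Binary.PropositionalEquality using (_≡_; _≢_)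
open import Relation.Binary.Construct.Closure.ReflexiveTransitive using (Star)

infixl 6 _⊕_
data Term : Set where
  C   : ℕ → Term
  V   : String → Term
  _⊕_ : Term → Term → Term

𝟘 : Term
𝟘 = C 0

infix 4 _≈X_
data _≈X_ : Term → Term → Set where
  ≈refl  : ∀ {s} → s ≈X s
  ≈sym   : ∀ {s t} → s ≈X t → t ≈X s
  ≈trans : ∀ {s t u} → s ≈X t → t ≈X u → s ≈X u
  ≈cong  : ∀ {s s′ t t′} → s ≈X s′ → t ≈X t′ → s ⊕ t ≈X s′ ⊕ t′
  ≈assoc : ∀ x y z → (x ⊕ y) ⊕ z ≈X x ⊕ (y ⊕ z)
  ≈comm  : ∀ x y → x ⊕ y ≈X y ⊕ x
  ≈unit  : ∀ x → 𝟘 ⊕ x ≈X x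
  ≈nil   : ∀ x → x ⊕ x ≈X 𝟘

-- Substitutions: finite-support maps, given as association lists
-- (the first binding of a variable wins; unbound variables map to
-- themselves), extended homomorphically to terms.

Subst : Set
Subst = List (String × Term)

lookupS : Subst → String → Term
lookupS []             x = V x
lookupS ((y , t) ∷ σ) x = if does (x Str.≟ y) then t else lookupS σ x

applyS : Subst → Term → Term
applyS σ (C n)   = C n
applyS σ (V x)   = lookupS σ x
applyS σ (s ⊕ t) = applyS σ s ⊕ applyS σ t

Problem : Set
Problem = List (Term × Term)

Solves : Subst → Problem → Set
Solves σ P = All (λ e → applyS σ (proj₁ e) ≈X applyS σ (proj₂ e)) P

IsMGU : Subst → Problem → Set
IsMGU σ P =
  Solves σ P ×
  (∀ (θ : Subst) → Solves θ P →
     ∃ λ (ρ : Subst) → ∀ (x : String) →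
       applyS θ (V x) ≈X applyS ρ (applyS σ (V x)))

data Atom : Set where
  cst : ℕ → Atom        -- a constant C n with n ≠ 0
  var : String → Atom

_=A_ : Atom → Atom → Bool
cst m =A cst n = does (m ℕ.≟ n)
var x =A var y = does (x Str.≟ y)
_     =A _     = false

toggle : Atom → List Atom → List Atom
toggle a []       = a ∷ []
toggle a (b ∷ bs) = if a =A b then bs else b ∷ toggle a bs

cancel : List Atom → List Atom
cancel = foldr toggle []

flatten : Term → List Atom
flatten (C zero)    = []
flatten (C (suc n)) = cst (suc n) ∷ []
flatten (V x)       = var x ∷ []
flatten (s ⊕ t)     = flatten s ++ flatten t

normalize : Term → List Atom
normalize t = cancel (flatten t)

atomTerm : Atom → Term
atomTerm (cst n) = C n
atomTerm (var x) = V x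

toTerm : List Atom → Term
toTerm []           = 𝟘
toTerm (a ∷ [])     = atomTerm a
toTerm (a ∷ b ∷ as) = atomTerm a ⊕ toTerm (b ∷ as)

substN : String → List Atom → List Atom → List Atom
substN x S e = cancel (concatMap (λ a → if a =A var x then S else a ∷ []) e)

-- The algorithm XORUnification as a transition system on Γ ‖ Λ.
-- An equation e ≈? 0 of Γ is represented by its (normalized) left side e;
-- an entry x ≈? S of Λ by the pair (x , S).

Eqs : Set
Eqs = List (List Atom)

Solved : Set
Solved = List (String × List Atom)

State : Set
State = Eqs × Solved

infix 4 _⇒_
data _⇒_ : State → State → Set where
  trivial : ∀ Γ₁ Γ₂ Λ → (Γ₁ ++ [] ∷ Γ₂ , Λ) ⇒ (Γ₁ ++ Γ₂ , Λ)
  -- (Variable Substitution), applicable only when (Trivial) is not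
  -- Γ ∪ {x ⊕ S ≈? 0} ‖ Λ ⇒ σΓ ‖ σΛ ∪ {x ≈? S},  x ∉ S,  σ = {x ↦ S}
  varSubst : ∀ Γ₁ Γ₂ Λ e x S →
    All (λ f → f ≢ []) (Γ₁ ++ e ∷ Γ₂) →
    e ↭ (var x ∷ S) → var x ∉ S →
    (Γ₁ ++ e ∷ Γ₂ , Λ) ⇒
    (map (substN x S) (Γ₁ ++ Γ₂) ,
     (x , S) ∷ map (λ p → proj₁ p , substN x S (proj₂ p)) Λ)

initState : Problem → State
initState P = map (λ e → normalize (proj₁ e ⊕ proj₂ e)) P , []

toSubst : Solved → Subst
toSubst = map (λ p → proj₁ p , toTerm (proj₂ p))

Returns : Problem → Subst → Set
Returns P σ = ∃ λ (Λ : Solved) → Star _⇒_ (initState P) ([] , Λ) × σ ≡ toSubst Λ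

-- Read a normal form back as the sum of its atoms. Then normalization, cancellation and
-- permutation do not change the value of a term modulo XOR, and an equation x ⊕ S ≈ 0 holds
-- under θ exactly when θ x ≈ θ S; hence replacing x by S elsewhere changes no equation.
-- So every step of the algorithm preserves the set of unifiers of Γ ‖ Λ, while keeping Λ in
-- solved form: its keys are distinct and occur nowhere else. A final state [] ‖ Λ is then
-- solved by σ = {x ↦ S} itself, and any unifier θ satisfies θ x ≈ θ S = θ (σ x), so θ
-- factors through σ with ρ = θ.
module Submission where

open import Defs

import Data.Nat as ℕ
open import Data.String using (String)
import Data.String as Str
open import Data.Bool using (true; false; if_then_else_)
open import Data.List using (List; []; _∷_; _++_; map; concatMap)
open import Data.List.Relation.Unary.All using (All; []; _∷_)
import Data.List.Relation.Unary.All as All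
import Data.List.Relation.Unary.All.Properties as All
open import Data.List.Relation.Unary.AllPairs using (AllPairs; []; _∷_)
import Data.List.Relation.Unary.AllPairs.Properties as AllPairs
open import Data.List.Relation.Unary.Any using (here; there)
open import Data.List.Membership.Propositional using (_∈_; _∉_; find)
open import Data.List.Membership.Propositional.Properties using (∈-concatMap⁻)
open import Data.List.Relation.Binary.Permutation.Propositional using (_↭_; ↭-sym)
import Data.List.Relation.Binary.Permutation.Propositional as ↭
open import Data.List.Relation.Binary.Permutation.Propositional.Properties using (∈-resp-↭)
open import Data.Product using (_×_; _,_; proj₁; proj₂)
open import Data.Sum using (_⊎_; inj₁; inj₂)
open import Data.Empty using (⊥-elim)
open import Function using (_∘_; id)
open import Function.Bundles using (_⇔_; mk⇔; Equivalence)
open import Function.Properties.Equivalence using () renaming (trans to ⇔-trans)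
open import Relation.Nullary using (does; proof)
open import Relation.Nullary.Decidable using (map′)
open import Relation.Nullary.Reflects using (Reflects; ofʸ; ofⁿ)
open import Relation.Binary.Bundles using (Setoid)
open import Relation.Binary.PropositionalEquality using (_≡_; _≢_; refl; cong)
open import Relation.Binary.Construct.Closure.ReflexiveTransitive using (Star; ε; _◅_)

open Equivalence using (to; from)

≈X-setoid : Setoid _ _
≈X-setoid = record
  { Carrier = Term
  ; _≈_ = _≈X_
  ; isEquivalence = record { refl = ≈refl ; sym = ≈sym ; trans = ≈trans }
  }

open import Relation.Binary.Reasoning.Setoid ≈X-setoid

⊕-identityʳ : ∀ a → a ⊕ 𝟘 ≈X a
⊕-identityʳ a = ≈trans (≈comm a 𝟘) (≈unit a)

⊕-cancelˡ : ∀ a b → a ⊕ (a ⊕ b) ≈X b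
⊕-cancelˡ a b = begin
  a ⊕ (a ⊕ b)  ≈⟨ ≈assoc a a b ⟨
  (a ⊕ a) ⊕ b  ≈⟨ ≈cong (≈nil a) ≈refl ⟩
  𝟘 ⊕ b        ≈⟨ ≈unit b ⟩
  b            ∎

⊕-exchange : ∀ a b c → a ⊕ (b ⊕ c) ≈X b ⊕ (a ⊕ c)
⊕-exchange a b c = begin
  a ⊕ (b ⊕ c)  ≈⟨ ≈assoc a b c ⟨
  (a ⊕ b) ⊕ c  ≈⟨ ≈cong (≈comm a b) ≈refl ⟩
  (b ⊕ a) ⊕ c  ≈⟨ ≈assoc b a c ⟩
  b ⊕ (a ⊕ c)  ∎

⊕≈𝟘⇒≈ : ∀ {a b} → a ⊕ b ≈X 𝟘 → a ≈X b
⊕≈𝟘⇒≈ {a} {b} a⊕b≈𝟘 = begin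
  a            ≈⟨ ⊕-identityʳ a ⟨
  a ⊕ 𝟘        ≈⟨ ≈cong ≈refl (≈nil b) ⟨
  a ⊕ (b ⊕ b)  ≈⟨ ≈assoc a b b ⟨
  (a ⊕ b) ⊕ b  ≈⟨ ≈cong a⊕b≈𝟘 ≈refl ⟩
  𝟘 ⊕ b        ≈⟨ ≈unit b ⟩
  b            ∎

≈⇒⊕≈𝟘 : ∀ {a b} → a ≈X b → a ⊕ b ≈X 𝟘
≈⇒⊕≈𝟘 {b = b} a≈b = ≈trans (≈cong a≈b ≈refl) (≈nil b)

applyS-resp-≈X : ∀ θ {s t} → s ≈X t → applyS θ s ≈X applyS θ t
applyS-resp-≈X θ ≈refl           = ≈refl
applyS-resp-≈X θ (≈sym p)        = ≈sym (applyS-resp-≈X θ p)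
applyS-resp-≈X θ (≈trans p q)    = ≈trans (applyS-resp-≈X θ p) (applyS-resp-≈X θ q)
applyS-resp-≈X θ (≈cong p q)     = ≈cong (applyS-resp-≈X θ p) (applyS-resp-≈X θ q)
applyS-resp-≈X θ (≈assoc _ _ _)  = ≈assoc _ _ _
applyS-resp-≈X θ (≈comm _ _)     = ≈comm _ _
applyS-resp-≈X θ (≈unit _)       = ≈unit _
applyS-resp-≈X θ (≈nil _)        = ≈nil _

=A-reflects : ∀ a b → Reflects (a ≡ b) (a =A b)
=A-reflects (cst m) (cst n) = proof (map′ (cong cst) (λ { refl → refl }) (m ℕ.≟ n))
=A-reflects (cst _) (var _) = ofⁿ λ ()
=A-reflects (var _) (cst _) = ofⁿ λ ()
=A-reflects (var x) (var y) = proof (map′ (cong var) (λ { refl → refl }) (x Str.≟ y))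

⟦_⟧ : List Atom → Term
⟦ [] ⟧     = 𝟘
⟦ a ∷ as ⟧ = atomTerm a ⊕ ⟦ as ⟧

toTerm≈⟦⟧ : ∀ as → toTerm as ≈X ⟦ as ⟧
toTerm≈⟦⟧ []           = ≈refl
toTerm≈⟦⟧ (a ∷ [])     = ≈sym (⊕-identityʳ _)
toTerm≈⟦⟧ (a ∷ b ∷ as) = ≈cong ≈refl (toTerm≈⟦⟧ (b ∷ as))

⟦++⟧ : ∀ as bs → ⟦ as ++ bs ⟧ ≈X ⟦ as ⟧ ⊕ ⟦ bs ⟧
⟦++⟧ []       bs = ≈sym (≈unit _)
⟦++⟧ (a ∷ as) bs = ≈trans (≈cong ≈refl (⟦++⟧ as bs)) (≈sym (≈assoc _ _ _))

⟦toggle⟧ : ∀ a bs → ⟦ toggle a bs ⟧ ≈X atomTerm a ⊕ ⟦ bs ⟧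
⟦toggle⟧ a []       = ≈refl
⟦toggle⟧ a (b ∷ bs) with a =A b | =A-reflects a b
... | true  | ofʸ refl = ≈sym (⊕-cancelˡ _ _)
... | false | ofⁿ _    = ≈trans (≈cong ≈refl (⟦toggle⟧ a bs)) (⊕-exchange _ _ _)

⟦cancel⟧ : ∀ as → ⟦ cancel as ⟧ ≈X ⟦ as ⟧
⟦cancel⟧ []       = ≈refl
⟦cancel⟧ (a ∷ as) = ≈trans (⟦toggle⟧ a (cancel as)) (≈cong ≈refl (⟦cancel⟧ as))

⟦flatten⟧ : ∀ t → ⟦ flatten t ⟧ ≈X t
⟦flatten⟧ (C ℕ.zero)    = ≈refl
⟦flatten⟧ (C (ℕ.suc n)) = ⊕-identityʳ _
⟦flatten⟧ (V x)         = ⊕-identityʳ _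
⟦flatten⟧ (s ⊕ t)       =
  ≈trans (⟦++⟧ (flatten s) (flatten t)) (≈cong (⟦flatten⟧ s) (⟦flatten⟧ t))

⟦normalize⟧ : ∀ t → ⟦ normalize t ⟧ ≈X t
⟦normalize⟧ t = ≈trans (⟦cancel⟧ (flatten t)) (⟦flatten⟧ t)

⟦⟧-resp-↭ : ∀ {as bs} → as ↭ bs → ⟦ as ⟧ ≈X ⟦ bs ⟧
⟦⟧-resp-↭ ↭.refl          = ≈refl
⟦⟧-resp-↭ (↭.prep _ p)    = ≈cong ≈refl (⟦⟧-resp-↭ p)
⟦⟧-resp-↭ (↭.swap _ _ p)  = ≈trans (⊕-exchange _ _ _) (≈cong ≈refl (≈cong ≈refl (⟦⟧-resp-↭ p)))
⟦⟧-resp-↭ (↭.trans p q)   = ≈trans (⟦⟧-resp-↭ p) (⟦⟧-resp-↭ q)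

instantiate : String → List Atom → Atom → List Atom
instantiate x S a = if a =A var x then S else a ∷ []

applyS-⟦concatMap-instantiate⟧ : ∀ θ {x S} → applyS θ (V x) ≈X applyS θ ⟦ S ⟧ →
  ∀ as → applyS θ ⟦ concatMap (instantiate x S) as ⟧ ≈X applyS θ ⟦ as ⟧
applyS-⟦concatMap-instantiate⟧ θ θx≈θS [] = ≈refl
applyS-⟦concatMap-instantiate⟧ θ {x} {S} θx≈θS (b ∷ bs)
  with b =A var x | =A-reflects b (var x)
... | true  | ofʸ refl = ≈trans (applyS-resp-≈X θ (⟦++⟧ S _))
                           (≈cong (≈sym θx≈θS) (applyS-⟦concatMap-instantiate⟧ θ θx≈θS bs))
... | false | ofⁿ _    = ≈cong ≈refl (applyS-⟦concatMap-instantiate⟧ θ θx≈θS bs)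

applyS-⟦substN⟧ : ∀ θ {x S} → applyS θ (V x) ≈X applyS θ ⟦ S ⟧ →
  ∀ as → applyS θ ⟦ substN x S as ⟧ ≈X applyS θ ⟦ as ⟧
applyS-⟦substN⟧ θ {x} {S} θx≈θS as =
  ≈trans (applyS-resp-≈X θ (⟦cancel⟧ (concatMap (instantiate x S) as)))
         (applyS-⟦concatMap-instantiate⟧ θ θx≈θS as)

∈-toggle⁻ : ∀ {a} b bs → a ∈ toggle b bs → a ≡ b ⊎ a ∈ bs
∈-toggle⁻ b []       (here a≡b) = inj₁ a≡b
∈-toggle⁻ b (c ∷ cs) a∈ with b =A c
... | true = inj₂ (there a∈)
... | false with a∈
...   | here a≡c = inj₂ (here a≡c)
...   | there a∈′ with ∈-toggle⁻ b cs a∈′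
...     | inj₁ a≡b  = inj₁ a≡b
...     | inj₂ a∈cs = inj₂ (there a∈cs)

∈-cancel⁻ : ∀ {a} bs → a ∈ cancel bs → a ∈ bs
∈-cancel⁻ (b ∷ bs) a∈ with ∈-toggle⁻ b (cancel bs) a∈
... | inj₁ a≡b = here a≡b
... | inj₂ a∈′ = there (∈-cancel⁻ bs a∈′)

∈-instantiate⁻ : ∀ {a x S} b → a ∈ instantiate x S b → a ∈ S ⊎ (a ≡ b × a ≢ var x)
∈-instantiate⁻ {x = x} b a∈ with b =A var x | =A-reflects b (var x)
... | true  | _         = inj₁ a∈
... | false | ofⁿ b≢x with a∈
...   | here refl = inj₂ (refl , b≢x)

∈-substN⁻ : ∀ {a} x S as → a ∈ substN x S as → a ∈ S ⊎ (a ∈ as × a ≢ var x)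
∈-substN⁻ x S as a∈ with find (∈-concatMap⁻ (instantiate x S) (∈-cancel⁻ _ a∈))
... | b , b∈as , a∈b with ∈-instantiate⁻ b a∈b
...   | inj₁ a∈S             = inj₁ a∈S
...   | inj₂ (refl , a≢x)    = inj₂ (b∈as , a≢x)

var∉substN-self : ∀ x S as → var x ∉ S → var x ∉ substN x S as
var∉substN-self x S as x∉S x∈ with ∈-substN⁻ x S as x∈
... | inj₁ x∈S       = x∉S x∈S
... | inj₂ (_ , x≢x) = x≢x refl

var∉substN : ∀ y x S as → var y ∉ as → var y ∉ S → var y ∉ substN x S as
var∉substN y x S as y∉as y∉S y∈ with ∈-substN⁻ x S as y∈
... | inj₁ y∈S        = y∉S y∈S
... | inj₂ (y∈as , _) = y∉as y∈as

SolvesΓ : Subst → Eqs → Set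
SolvesΓ θ = All (λ e → applyS θ ⟦ e ⟧ ≈X 𝟘)

SolvesΛ : Subst → Solved → Set
SolvesΛ θ = All (λ p → applyS θ (V (proj₁ p)) ≈X applyS θ ⟦ proj₂ p ⟧)

SolvesState : Subst → State → Set
SolvesState θ (Γ , Λ) = SolvesΓ θ Γ × SolvesΛ θ Λ

KeysDistinct : Solved → Set
KeysDistinct = AllPairs (λ p q → proj₁ p ≢ proj₁ q)

Eliminated : String → State → Set
Eliminated y (Γ , Λ) = All (var y ∉_) Γ × All (λ p → var y ∉ proj₂ p) Λ

SolvedForm : State → Set
SolvedForm (Γ , Λ) = KeysDistinct Λ × All (λ p → Eliminated (proj₁ p) (Γ , Λ)) Λ

module _ {P : List Atom → Set} where

  All-++-∷⁻ : ∀ xs {y ys} → All P (xs ++ y ∷ ys) → P y × All P (xs ++ ys)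
  All-++-∷⁻ xs h with All.++⁻ xs h
  ... | pxs , py ∷ pys = py , All.++⁺ pxs pys

  All-++-∷⁺ : ∀ xs {y ys} → P y → All P (xs ++ ys) → All P (xs ++ y ∷ ys)
  All-++-∷⁺ xs py h with All.++⁻ xs h
  ... | pxs , pys = All.++⁺ pxs (py ∷ pys)

zero-sum⇔binding : ∀ θ {e x S} → e ↭ var x ∷ S →
  applyS θ ⟦ e ⟧ ≈X 𝟘 ⇔ applyS θ (V x) ≈X applyS θ ⟦ S ⟧
zero-sum⇔binding θ e↭xS = mk⇔
  (λ h → ⊕≈𝟘⇒≈ (≈trans (≈sym (applyS-resp-≈X θ (⟦⟧-resp-↭ e↭xS))) h))
  (λ h → ≈trans (applyS-resp-≈X θ (⟦⟧-resp-↭ e↭xS)) (≈⇒⊕≈𝟘 h))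

module VariableSubstitution (Γ₁ Γ₂ : Eqs) (Λ : Solved) (e : List Atom) (x : String)
  (S : List Atom) (e↭xS : e ↭ var x ∷ S) (x∉S : var x ∉ S) where

  substEntry : String × List Atom → String × List Atom
  substEntry (y , T) = y , substN x S T

  before after : State
  before = Γ₁ ++ e ∷ Γ₂ , Λ
  after  = map (substN x S) (Γ₁ ++ Γ₂) , (x , S) ∷ map substEntry Λ

  preserves-unifiers : ∀ θ → SolvesState θ before ⇔ SolvesState θ after
  preserves-unifiers θ = mk⇔ forward backward
    where
      forward : SolvesState θ before → SolvesState θ after
      forward (solvesΓ , solvesΛ) with All-++-∷⁻ Γ₁ solvesΓ
      ... | θe≈𝟘 , solvesΓ′ =
        All.map⁺ (All.map (λ {f} h → ≈trans (applyS-⟦substN⟧ θ θx≈θS f) h) solvesΓ′) ,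
        θx≈θS ∷ All.map⁺ (All.map (λ {p} h → ≈trans h (≈sym (applyS-⟦substN⟧ θ θx≈θS (proj₂ p))))
                                  solvesΛ)
        where θx≈θS = to (zero-sum⇔binding θ e↭xS) θe≈𝟘

      backward : SolvesState θ after → SolvesState θ before
      backward (solvesΓ′ , θx≈θS ∷ solvesΛ′) =
        All-++-∷⁺ Γ₁ (from (zero-sum⇔binding θ e↭xS) θx≈θS)
          (All.map (λ {f} h → ≈trans (≈sym (applyS-⟦substN⟧ θ θx≈θS f)) h) (All.map⁻ solvesΓ′)) ,
        All.map (λ {p} h → ≈trans h (applyS-⟦substN⟧ θ θx≈θS (proj₂ p))) (All.map⁻ solvesΛ′)

  x-eliminated : Eliminated x after
  x-eliminated =
    All.map⁺ (All.universal (λ f → var∉substN-self x S f x∉S) (Γ₁ ++ Γ₂)) ,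
    x∉S ∷ All.map⁺ (All.universal (λ p → var∉substN-self x S (proj₂ p) x∉S) Λ)

  old-key-stays-eliminated : ∀ y → Eliminated y before → x ≢ y × Eliminated y after
  old-key-stays-eliminated y (y∉Γ , y∉Λ) =
    (λ { refl → y∉e (∈-resp-↭ (↭-sym e↭xS) (here refl)) }) ,
    All.map⁺ (All.map (λ {f} y∉f → var∉substN y x S f y∉f y∉S) y∉Γ′) ,
    y∉S ∷ All.map⁺ (All.map (λ {p} y∉T → var∉substN y x S (proj₂ p) y∉T y∉S) y∉Λ)
    where
      y∉e = proj₁ (All-++-∷⁻ Γ₁ y∉Γ)
      y∉Γ′ = proj₂ (All-++-∷⁻ Γ₁ y∉Γ)
      y∉S : var y ∉ S
      y∉S = y∉e ∘ ∈-resp-↭ (↭-sym e↭xS) ∘ there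

  preserves-solvedForm : SolvedForm before → SolvedForm after
  preserves-solvedForm (distinct , eliminated) =
    All.map⁺ (All.map (λ {p} → proj₁ ∘ old-key-stays-eliminated (proj₁ p)) eliminated)
      ∷ AllPairs.map⁺ distinct ,
    x-eliminated
      ∷ All.map⁺ (All.map (λ {p} → proj₂ ∘ old-key-stays-eliminated (proj₁ p)) eliminated)

⇒-preserves-unifiers : ∀ {s t} → s ⇒ t → ∀ θ → SolvesState θ s ⇔ SolvesState θ t
⇒-preserves-unifiers (trivial Γ₁ Γ₂ Λ) θ = mk⇔
  (λ (solvesΓ , solvesΛ) → proj₂ (All-++-∷⁻ Γ₁ solvesΓ) , solvesΛ)
  (λ (solvesΓ , solvesΛ) → All-++-∷⁺ Γ₁ ≈refl solvesΓ , solvesΛ)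
⇒-preserves-unifiers (varSubst Γ₁ Γ₂ Λ e x S _ e↭xS x∉S) =
  VariableSubstitution.preserves-unifiers Γ₁ Γ₂ Λ e x S e↭xS x∉S

⇒-preserves-solvedForm : ∀ {s t} → s ⇒ t → SolvedForm s → SolvedForm t
⇒-preserves-solvedForm (trivial Γ₁ Γ₂ Λ) (distinct , eliminated) =
  distinct , All.map (λ (y∉Γ , y∉Λ) → proj₂ (All-++-∷⁻ Γ₁ y∉Γ) , y∉Λ) eliminated
⇒-preserves-solvedForm (varSubst Γ₁ Γ₂ Λ e x S _ e↭xS x∉S) =
  VariableSubstitution.preserves-solvedForm Γ₁ Γ₂ Λ e x S e↭xS x∉S

⇒*-preserves-unifiers : ∀ {s t} → Star _⇒_ s t → ∀ θ → SolvesState θ s ⇔ SolvesState θ t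
⇒*-preserves-unifiers ε             θ = mk⇔ id id
⇒*-preserves-unifiers (step ◅ steps) θ =
  ⇔-trans (⇒-preserves-unifiers step θ) (⇒*-preserves-unifiers steps θ)

⇒*-preserves-solvedForm : ∀ {s t} → Star _⇒_ s t → SolvedForm s → SolvedForm t
⇒*-preserves-solvedForm ε              = id
⇒*-preserves-solvedForm (step ◅ steps) =
  ⇒*-preserves-solvedForm steps ∘ ⇒-preserves-solvedForm step

initState-solvedForm : ∀ P → SolvedForm (initState P)
initState-solvedForm P = [] , []

solves⇔solves-initState : ∀ P θ → Solves θ P ⇔ SolvesState θ (initState P)
solves⇔solves-initState P θ = mk⇔
  (λ h → All.map⁺ (All.map (λ {e} h → ≈trans (value e) (≈⇒⊕≈𝟘 h)) h) , [])
  (λ (h , _) → All.map (λ {e} h → ⊕≈𝟘⇒≈ (≈trans (≈sym (value e)) h)) (All.map⁻ h))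
  where
    value : ∀ (e : Term × Term) → applyS θ ⟦ normalize (proj₁ e ⊕ proj₂ e) ⟧
                                   ≈X applyS θ (proj₁ e) ⊕ applyS θ (proj₂ e)
    value (s , t) = applyS-resp-≈X θ (⟦normalize⟧ (s ⊕ t))

-- Matching on does/proof rather than on z ≟ y itself: does (z ≟ y) unfolds in the goal,
-- so a plain with could not abstract it.
lookupS-toSubst-∉ : ∀ Λ z → All (λ p → z ≢ proj₁ p) Λ → lookupS (toSubst Λ) z ≡ V z
lookupS-toSubst-∉ []            z []          = refl
lookupS-toSubst-∉ ((y , T) ∷ Λ) z (z≢y ∷ z∉Λ) with does (z Str.≟ y) | proof (z Str.≟ y)
... | true  | ofʸ z≡y = ⊥-elim (z≢y z≡y)
... | false | _       = lookupS-toSubst-∉ Λ z z∉Λ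

lookupS-toSubst-∈ : ∀ {Λ y T} → KeysDistinct Λ → (y , T) ∈ Λ → lookupS (toSubst Λ) y ≡ toTerm T
lookupS-toSubst-∈ {(y , T) ∷ Λ} _ (here refl) with does (y Str.≟ y) | proof (y Str.≟ y)
... | true  | _       = refl
... | false | ofⁿ y≢y = ⊥-elim (y≢y refl)
lookupS-toSubst-∈ {(z , _) ∷ Λ} {y} (z≢Λ ∷ distinct) (there yT∈Λ)
  with does (y Str.≟ z) | proof (y Str.≟ z)
... | true  | ofʸ refl = ⊥-elim (All.lookup z≢Λ yT∈Λ refl)
... | false | _        = lookupS-toSubst-∈ distinct yT∈Λ

applyS-toSubst-⟦⟧-fresh : ∀ Λ S → All (λ p → var (proj₁ p) ∉ S) Λ →
  applyS (toSubst Λ) ⟦ S ⟧ ≡ ⟦ S ⟧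
applyS-toSubst-⟦⟧-fresh Λ []          _     = refl
applyS-toSubst-⟦⟧-fresh Λ (cst n ∷ S) fresh =
  cong (C n ⊕_) (applyS-toSubst-⟦⟧-fresh Λ S (All.map (_∘ there) fresh))
applyS-toSubst-⟦⟧-fresh Λ (var z ∷ S) fresh
  rewrite lookupS-toSubst-∉ Λ z (All.map (λ z∉S → λ { refl → z∉S (here refl) }) fresh) =
  cong (V z ⊕_) (applyS-toSubst-⟦⟧-fresh Λ S (All.map (_∘ there) fresh))

toSubst-solves-solvedForm : ∀ Λ → SolvedForm ([] , Λ) → SolvesΛ (toSubst Λ) Λ
toSubst-solves-solvedForm Λ (distinct , eliminated) = All.tabulate solves-entry
  where
    solves-entry : ∀ {p} → p ∈ Λ → applyS (toSubst Λ) (V (proj₁ p)) ≈X applyS (toSubst Λ) ⟦ proj₂ p ⟧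
    solves-entry {y , T} yT∈Λ
      rewrite lookupS-toSubst-∈ distinct yT∈Λ
            | applyS-toSubst-⟦⟧-fresh Λ T
                (All.tabulate (λ q∈Λ → All.lookup (proj₂ (All.lookup eliminated q∈Λ)) yT∈Λ))
      = toTerm≈⟦⟧ T

factors-through-toSubst : ∀ θ Λ → SolvesΛ θ Λ →
  ∀ z → applyS θ (V z) ≈X applyS θ (lookupS (toSubst Λ) z)
factors-through-toSubst θ []            _                  z = ≈refl
factors-through-toSubst θ ((y , T) ∷ Λ) (θy≈θT ∷ solvesΛ) z
  with does (z Str.≟ y) | proof (z Str.≟ y)
... | true  | ofʸ refl = ≈trans θy≈θT (≈sym (applyS-resp-≈X θ (toTerm≈⟦⟧ T)))
... | false | _        = factors-through-toSubst θ Λ solvesΛ z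

mainTheorem2 : (P : Problem) (σ : Subst) → Returns P σ → IsMGU σ P
mainTheorem2 P σ (Λ , run , refl) =
  from (unifiers σ) ([] , toSubst-solves-solvedForm Λ solvedForm) ,
  λ θ θ-solves → θ , factors-through-toSubst θ Λ (proj₂ (to (unifiers θ) θ-solves))
  where
    unifiers : ∀ θ → Solves θ P ⇔ SolvesState θ ([] , Λ)
    unifiers θ = ⇔-trans (solves⇔solves-initState P θ) (⇒*-preserves-unifiers run θ)

    solvedForm : SolvedForm ([] , Λ)
    solvedForm = ⇒*-preserves-solvedForm run (initState-solvedForm P)
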